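{- Let $I$ be an SF instance and $\Pi$ a GSP of $I$. If $\Pi$ is reduced and contains no cycle of odd length greater than 1, then the set $M=\{\{a_i,a_j\} : (a_i\ a_j)\in\Pi\}$ of pairs forming the transpositions of $\Pi$ is a stable matching of $I$.
   Context: A Stable Fixtures (SF) instance is $I=(A,\succ,c)$ where $A=\{a_1,\dots,a_n\}$ is a finite set of $n$ agents; each agent $a_i$ has a strict linear order $\succ_i$ over $A\setminus\{a_i\}$ (complete preference list), with the convention that every agent ranks itself last ($a_j\succ_i a_i$ for all $j\neq i$); $a\succeq_i b$ means $a\succ_i b$ or $a=b$. Each agent has an integer capacity $c_i$ with $1\le c_i<n$. A matching is a set $M$ of unordered pairs of distinct agents such that each $a_i$ lies in at most $c_i$ pairs; $M(a_i)$ is the set of partners of $a_i$ and worst$_i(M(a_i))$ its $\succ_i$-worst partner. A blocking pair of $M$ is a pair of distinct agents $a_i,a_j$ with $\{a_i,a_j\}\notin M$, ($|M(a_j)|<c_j$ or $a_i\succ_j$ worst$_j(M(a_j))$), and ($|M(a_i)|<c_i$ or $a_j\succ_i$ worst$_i(M(a_i))$). $M$ is stable if it has no blocking pair. A cyclic permutation of a nonempty set $A_r\subseteq A$ is a permutation $\Pi_r$ of $A_r$ consisting of a single cycle of length $|A_r|$ (length 1: a fixed point $(a_i)$; length 2: a transposition $(a_i\ a_j)$). Two cyclic permutations are distinct if some element is mapped to different elements by them. A GSP (generalised stable partition) of $I$ is a finite collection $\Pi=\{\Pi_1,\dots,\Pi_k\}$ of cyclic permutations $\Pi_r$ of sets $A_r\subseteq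 A$, pairwise distinct except that fixed points may be repeated, such that: (F1) for every $r$ and every $a_j\in A_r$, $\Pi_r(a_j)\succeq_j\Pi_r^{ -1}(a_j)$; (F2) there are no distinct $a_i,a_j\in A$ with the transposition $(a_i\ a_j)\notin\Pi$ such that $a_j\succ_i\Pi_r^{ -1}(a_i)$ and $a_i\succ_j\Pi_s^{ -1}(a_j)$ for some $\Pi_r,\Pi_s\in\Pi$ with $a_i\in A_r$, $a_j\in A_s$; (F3) for every $a_i\in A$, the number of indices $r$ with $a_i\in A_r$ equals $c_i$; (F4) for all distinct $a_i,a_j\in A$, $|\{s:\Pi_s(a_i)=a_j\}|+|\{s:\Pi_s(a_j)=a_i\}|\le 2$. A GSP is reduced if it contains no cyclic permutation of even length greater than 2. -}

module Defs where

open import Data.Nat using (ℕ; zero; suc; _+_; _*_; _≤_; _<_)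
open import Data.Nat.Properties using (_≤?_)
open import Data.Fin using (Fin; _≟_)
open import Data.Fin.Properties using (any?)
open import Data.List using (List; []; _∷_; length; filter; reverse; allFin)
open import Data.List.Properties using (≡-dec)
open import Data.List.Membership.Propositional using (_∈_)
open import Data.List.Relation.Unary.Unique.Propositional using (Unique)
open import Data.Product using (Σ; ∃; ∃-syntax; _×_; _,_)
open import Data.Sum using (_⊎_)
open import Relation.Nullary using (¬_; Dec; yes; no)
open import Relation.Nullary.Decidable using (_⊎-dec_; _×-dec_)
open import Relation.Binary.PropositionalEquality using (_≡_; _≢_)
open import Relation.Unary using (Decidable)

-- The strict preference order ≻_i of
-- agent i is encoded by an injective rank function: a ≻_i b iff
-- rank i a < rank i b (smaller rank = more preferred).

record SF (n : ℕ) : Set where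
  field
    rank     : Fin n → Fin n → ℕ
    rank-inj : ∀ i a b → rank i a ≡ rank i b → a ≡ b
    selfLast : ∀ i j → j ≢ i → rank i j < rank i i
    cap      : Fin n → ℕ
    cap-pos  : ∀ i → 1 ≤ cap i
    cap-lt   : ∀ i → cap i < n

module _ {n : ℕ} (I : SF n) where
  open SF I

  Prefers : Fin n → Fin n → Fin n → Set
  Prefers i a b = rank i a < rank i b

  PrefersEq : Fin n → Fin n → Fin n → Set
  PrefersEq i a b = rank i a ≤ rank i b

  -- ≻_i-worst element of a nonempty list (i itself for the empty list;
  -- never used in that case)
  worstOf : Fin n → List (Fin n) → Fin n
  worstOf i [] = i
  worstOf i (p ∷ ps) = go p ps
    where
    worse : Fin n → Fin n → Fin n
    worse w q with rank i q ≤? rank i w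
    ... | yes _ = w
    ... | no _  = q
    go : Fin n → List (Fin n) → Fin n
    go w [] = w
    go w (q ∷ qs) = go (worse w q) qs

count : ∀ {k} {P : Fin k → Set} → Decidable P → ℕ
count {k} P? = length (filter P? (allFin k))

-- Matchings, given as a decidable relation M (M a b : {a,b} ∈ M).

module _ {n : ℕ} (I : SF n) (M : Fin n → Fin n → Set)
         (M? : ∀ a b → Dec (M a b)) where
  open SF I

  partners : Fin n → List (Fin n)
  partners a = filter (M? a) (allFin n)

  deg : Fin n → ℕ
  deg a = length (partners a)

  worst : Fin n → Fin n
  worst a = worstOf I a (partners a)

  IsMatching : Set
  IsMatching = (∀ a b → M a b → M b a)
             × (∀ a → ¬ M a a)
             × (∀ a → deg a ≤ cap a)

  BlockingPair : Fin n → Fin n → Set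
  BlockingPair i j =
      i ≢ j
    × ¬ M i j
    × (deg j < cap j ⊎ Prefers I j i (worst j))
    × (deg i < cap i ⊎ Prefers I i j (worst i))

  Stable : Set
  Stable = ∀ i j → ¬ BlockingPair i j

  IsStableMatching : Set
  IsStableMatching = IsMatching × Stable

-- Cyclic permutations, represented by a nonempty duplicate-free list
-- [x₀, …, x_{m-1}] of the agents of A_r, meaning x_t ↦ x_{t+1 mod m}.

-- successor of a in the cyclic list (h = first element, for wrap-around)
private
  headOr : ∀ {n} → List (Fin n) → Fin n → Fin n
  headOr [] h = h
  headOr (z ∷ _) _ = z

  nextIn : ∀ {n} → Fin n → List (Fin n) → Fin n → Fin n
  nextIn h [] a = a
  nextIn h (y ∷ ys) a with a ≟ y
  ... | yes _ = headOr ys h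
  ... | no _  = nextIn h ys a

-- Π_r(a)  (identity outside the support)
next : ∀ {n} → List (Fin n) → Fin n → Fin n
next [] a = a
next (x ∷ xs) a = nextIn x (x ∷ xs) a

prev : ∀ {n} → List (Fin n) → Fin n → Fin n
prev C a = next (reverse C) a

WFCycle : ∀ {n} → List (Fin n) → Set
WFCycle C = (1 ≤ length C) × Unique C

-- two cyclic permutations are the same partial map (same support and
-- same images); "distinct" = not SameCycle
SameCycle : ∀ {n} → List (Fin n) → List (Fin n) → Set
SameCycle C D = (∀ a → (a ∈ C → a ∈ D) × (a ∈ D → a ∈ C))
              × (∀ a → a ∈ C → next C a ≡ next D a)

IsTransp : ∀ {n} → Fin n → Fin n → List (Fin n) → Set
IsTransp a b C = (C ≡ a ∷ b ∷ []) ⊎ (C ≡ b ∷ a ∷ [])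

isTransp? : ∀ {n} (a b : Fin n) (C : List (Fin n)) → Dec (IsTransp a b C)
isTransp? a b C = ≡-dec _≟_ C (a ∷ b ∷ []) ⊎-dec ≡-dec _≟_ C (b ∷ a ∷ [])

Even Odd : ℕ → Set
Even m = ∃[ t ] m ≡ 2 * t
Odd m = ∃[ t ] m ≡ 1 + 2 * t

record Family (n : ℕ) : Set where
  field
    k   : ℕ
    cyc : Fin k → List (Fin n)

module _ {n : ℕ} (I : SF n) (Π : Family n) where
  open SF I
  open Family Π
  open import Data.List.Membership.DecPropositional (_≟_ {n}) using (_∈?_)

  TranspIn : Fin n → Fin n → Set
  TranspIn a b = ∃[ r ] IsTransp a b (cyc r)

  TranspIn? : ∀ a b → Dec (TranspIn a b)
  TranspIn? a b = any? (λ r → isTransp? a b (cyc r))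

  IsGSP : Set
  IsGSP =
      (∀ r → WFCycle (cyc r))
      -- pairwise distinct, except that fixed points may be repeated
    × (∀ r s → r ≢ s → 2 ≤ length (cyc r) → ¬ SameCycle (cyc r) (cyc s))
    × (∀ r a → a ∈ cyc r → PrefersEq I a (next (cyc r) a) (prev (cyc r) a))
      -- (F2)
    × (∀ a b → a ≢ b → ¬ TranspIn a b →
         ¬ (∃[ r ] ∃[ s ] (a ∈ cyc r × b ∈ cyc s
              × Prefers I a b (prev (cyc r) a)
              × Prefers I b a (prev (cyc s) b))))
      -- (F3)
    × (∀ a → count (λ r → a ∈? cyc r) ≡ cap a)
    × (∀ a b → a ≢ b →
         count (λ r → (a ∈? cyc r) ×-dec (next (cyc r) a ≟ b))
         + count (λ r → (b ∈? cyc r) ×-dec (next (cyc r) b ≟ a)) ≤ 2)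

  Reduced : Set
  Reduced = ∀ r → ¬ (Even (length (cyc r)) × 2 < length (cyc r))

  NoOddCycle>1 : Set
  NoOddCycle>1 = ∀ r → ¬ (Odd (length (cyc r)) × 1 < length (cyc r))

  transpMatching : Fin n → Fin n → Set
  transpMatching = TranspIn

-- Both extra hypotheses force every cycle of Π to have length 1 or 2, so an agent a
-- either lies in a fixed point (a) or every cycle through a is a transposition. In the
-- latter case the distinct cycles through a are distinct transpositions, so by (F3) the
-- agent has exactly cap a partners in M; and for every cycle Π_r ∋ a the predecessor
-- Π_r⁻¹(a) is an M-partner of a. A side of a blocking pair {a, b} therefore yields a
-- cycle Π_r ∋ a with b ≻_a Π_r⁻¹(a): via the fixed point if a has one (a ranks itself
-- last), and via the worst M-partner of a otherwise (a is full). Two such sides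
-- contradict (F2).
module Submission where

open import Defs
open import Data.Nat using (ℕ; zero; suc; _≤_; _<_; z≤n; s≤s)
open import Data.Nat.Properties
  using (≤-trans; <-irrefl; <-≤-trans; <⇒≤; _≤?_; ≰⇒>; *-suc; module ≤-Reasoning)
open import Data.Fin using (Fin; _≟_)
open import Data.Fin.Properties using (any?)
open import Data.List using (List; []; _∷_; length; map; filter; allFin)
open import Data.List.Properties using (≡-dec; length-map; length-removeAt′)
open import Data.List.Membership.Propositional using (_∈_; _─_)
open import Data.List.Membership.Propositional.Properties
  using (∈-filter⁺; ∈-filter⁻; ∈-allFin; ∈-map⁺; ∈-map⁻)
open import Data.List.Relation.Binary.Subset.Propositional using (_⊆_)
open import Data.List.Relation.Unary.Any using (here; there)
open import Data.List.Relation.Unary.All as All using ([]; _∷_)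
open import Data.List.Relation.Unary.All.Properties as All using ()
open import Data.List.Relation.Unary.AllPairs using ([]; _∷_)
open import Data.List.Relation.Unary.Unique.Propositional using (Unique)
open import Data.List.Relation.Unary.Unique.Propositional.Properties using (filter⁺; allFin⁺)
open import Data.Product using (∃-syntax; _×_; _,_; proj₁; proj₂)
open import Data.Sum using (_⊎_; inj₁; inj₂)
open import Data.Empty using (⊥-elim)
open import Relation.Nullary using (¬_; Dec; yes; no)
open import Relation.Binary.PropositionalEquality using (_≡_; _≢_; refl; sym; trans; cong; subst; ≢-sym)
open import Relation.Unary using (Decidable)

module _ {A : Set} where

  ∈-─⁺ : ∀ {x y : A} {ys} (y∈ys : y ∈ ys) → x ∈ ys → x ≢ y → x ∈ ys ─ y∈ys
  ∈-─⁺ (here refl) (here refl) x≢y = ⊥-elim (x≢y refl)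
  ∈-─⁺ (here refl) (there x∈ys) _  = x∈ys
  ∈-─⁺ (there _)   (here refl)  _  = here refl
  ∈-─⁺ (there y∈ys) (there x∈ys) x≢y = there (∈-─⁺ y∈ys x∈ys x≢y)

  Unique-⊆⇒length≤ : ∀ {xs ys : List A} → Unique xs → xs ⊆ ys → length xs ≤ length ys
  Unique-⊆⇒length≤ {[]}     _          _  = z≤n
  Unique-⊆⇒length≤ {x ∷ xs} {ys} (x∉xs ∷ u) xs⊆ys =
    subst (suc (length xs) ≤_) (sym (length-removeAt′ ys _))
      (s≤s (Unique-⊆⇒length≤ u λ z∈xs →
        ∈-─⁺ x∈ys (xs⊆ys (there z∈xs)) (λ z≡x → All.lookup x∉xs z∈xs (sym z≡x))))
    where x∈ys = xs⊆ys (here refl)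

  Unique-map⁺ : ∀ {B : Set} {f : A → B} {xs} →
                (∀ {x y} → x ∈ xs → y ∈ xs → f x ≡ f y → x ≡ y) →
                Unique xs → Unique (map f xs)
  Unique-map⁺ inj [] = []
  Unique-map⁺ inj (x∉xs ∷ u) =
    All.map⁺ (All.tabulate λ y∈xs fx≡fy → All.lookup x∉xs y∈xs (inj (here refl) (there y∈xs) fx≡fy))
    ∷ Unique-map⁺ (λ x∈ y∈ → inj (there x∈) (there y∈)) u

module _ {k : ℕ} {R : Fin k → Set} (R? : Decidable R) where

  ∈-counted⁺ : ∀ {x} → R x → x ∈ filter R? (allFin k)
  ∈-counted⁺ = ∈-filter⁺ R? (∈-allFin _)

  ∈-counted⁻ : ∀ {x} → x ∈ filter R? (allFin k) → R x
  ∈-counted⁻ x∈ = proj₂ (∈-filter⁻ R? {xs = allFin k} x∈)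

module _ {k m : ℕ} {P : Fin k → Set} {Q : Fin m → Set} (P? : Decidable P) (Q? : Decidable Q) where
  open ≤-Reasoning

  count-≤-surjection : (f : Fin k → Fin m) → (∀ {y} → Q y → ∃[ x ] P x × f x ≡ y) →
                       count Q? ≤ count P?
  count-≤-surjection f surj = begin
    count Q?                               ≤⟨ Unique-⊆⇒length≤ (filter⁺ Q? (allFin⁺ m)) covered ⟩
    length (map f (filter P? (allFin k)))  ≡⟨ length-map f (filter P? (allFin k)) ⟩
    count P?                               ∎
    where
    covered : filter Q? (allFin m) ⊆ map f (filter P? (allFin k))
    covered y∈ with surj (∈-counted⁻ Q? y∈)
    ... | x , Px , refl = ∈-map⁺ f (∈-counted⁺ P? Px)

  count-≤-injection : (f : Fin k → Fin m) → (∀ {x} → P x → Q (f x)) →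
                      (∀ {x y} → P x → P y → f x ≡ f y → x ≡ y) → count P? ≤ count Q?
  count-≤-injection f maps inj = begin
    count P?                               ≡⟨ length-map f (filter P? (allFin k)) ⟨
    length (map f (filter P? (allFin k)))  ≤⟨ Unique-⊆⇒length≤ unique image ⟩
    count Q?                               ∎
    where
    unique : Unique (map f (filter P? (allFin k)))
    unique = Unique-map⁺ (λ x∈ y∈ → inj (∈-counted⁻ P? x∈) (∈-counted⁻ P? y∈)) (filter⁺ P? (allFin⁺ k))
    image : map f (filter P? (allFin k)) ⊆ filter Q? (allFin m)
    image y∈ with ∈-map⁻ f y∈
    ... | x , x∈ , refl = ∈-counted⁺ Q? (maps (∈-counted⁻ P? x∈))

even⊎odd : ∀ m → Even m ⊎ Odd m
even⊎odd zero = inj₁ (0 , refl)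
even⊎odd (suc m) with even⊎odd m
... | inj₁ (t , m≡2t)   = inj₂ (t , cong suc m≡2t)
... | inj₂ (t , m≡1+2t) = inj₁ (suc t , trans (cong suc m≡1+2t) (sym (*-suc 2 t)))

≤2-if-not-even>2-nor-odd>1 : ∀ m → ¬ (Even m × 2 < m) → ¬ (Odd m × 1 < m) → m ≤ 2
≤2-if-not-even>2-nor-odd>1 m ¬even>2 ¬odd>1 with m ≤? 2
... | yes m≤2 = m≤2
... | no m≰2 with even⊎odd m
...   | inj₁ even = ⊥-elim (¬even>2 (even , ≰⇒> m≰2))
...   | inj₂ odd  = ⊥-elim (¬odd>1 (odd , <⇒≤ (≰⇒> m≰2)))

module _ {n : ℕ} where

  next-fst : ∀ (a b : Fin n) → next (a ∷ b ∷ []) a ≡ b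
  next-fst a b with a ≟ a
  ... | yes _  = refl
  ... | no a≢a = ⊥-elim (a≢a refl)

  next-snd : ∀ {a b : Fin n} → a ≢ b → next (a ∷ b ∷ []) b ≡ a
  next-snd {a} {b} a≢b with b ≟ a
  ... | yes b≡a = ⊥-elim (a≢b (sym b≡a))
  ... | no _ with b ≟ b
  ...   | yes _  = refl
  ...   | no b≢b = ⊥-elim (b≢b refl)

  prev-singleton : ∀ (a : Fin n) → prev (a ∷ []) a ≡ a
  prev-singleton a with a ≟ a
  ... | yes _  = refl
  ... | no a≢a = ⊥-elim (a≢a refl)

  IsTransp-sym : ∀ {a b : Fin n} {C} → IsTransp a b C → IsTransp b a C
  IsTransp-sym (inj₁ C≡ab) = inj₂ C≡ab
  IsTransp-sym (inj₂ C≡ba) = inj₁ C≡ba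

  IsTransp⇒≢ : ∀ {a b : Fin n} {C} → Unique C → IsTransp a b C → a ≢ b
  IsTransp⇒≢ u (inj₁ refl) with u
  ... | (a≢b ∷ []) ∷ _ = a≢b
  IsTransp⇒≢ u (inj₂ refl) with u
  ... | (b≢a ∷ []) ∷ _ = λ a≡b → b≢a (sym a≡b)

  IsTransp⇒∈ : ∀ {a b : Fin n} {C} → IsTransp a b C → a ∈ C
  IsTransp⇒∈ (inj₁ refl) = here refl
  IsTransp⇒∈ (inj₂ refl) = there (here refl)

  IsTransp⇒2≤length : ∀ {a b : Fin n} {C} → IsTransp a b C → 2 ≤ length C
  IsTransp⇒2≤length (inj₁ refl) = s≤s (s≤s z≤n)
  IsTransp⇒2≤length (inj₂ refl) = s≤s (s≤s z≤n)

  ∈-IsTransp : ∀ {a b x : Fin n} {C} → IsTransp a b C → x ∈ C → x ≡ a ⊎ x ≡ b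
  ∈-IsTransp (inj₁ refl) (here x≡a)         = inj₁ x≡a
  ∈-IsTransp (inj₁ refl) (there (here x≡b)) = inj₂ x≡b
  ∈-IsTransp (inj₂ refl) (here x≡b)         = inj₂ x≡b
  ∈-IsTransp (inj₂ refl) (there (here x≡a)) = inj₁ x≡a

  next-IsTransp : ∀ {a b : Fin n} {C} → a ≢ b → IsTransp a b C → next C a ≡ b
  next-IsTransp {a} {b} _   (inj₁ refl) = next-fst a b
  next-IsTransp         a≢b (inj₂ refl) = next-snd (≢-sym a≢b)

  prev-IsTransp : ∀ {a b : Fin n} {C} → a ≢ b → IsTransp a b C → prev C a ≡ b
  prev-IsTransp         a≢b (inj₁ refl) = next-snd (≢-sym a≢b)
  prev-IsTransp {a} {b} _   (inj₂ refl) = next-fst a b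

  IsTransp⇒SameCycle : ∀ {a b : Fin n} {C D} → a ≢ b →
                       IsTransp a b C → IsTransp a b D → SameCycle C D
  IsTransp⇒SameCycle {a} {b} {C} {D} a≢b abC abD = (λ x → ∈-transp⇒∈ abC abD , ∈-transp⇒∈ abD abC) , sameNext
    where
    ∈-transp⇒∈ : ∀ {x E F} → IsTransp a b E → IsTransp a b F → x ∈ E → x ∈ F
    ∈-transp⇒∈ abE abF x∈E with ∈-IsTransp abE x∈E
    ... | inj₁ refl = IsTransp⇒∈ abF
    ... | inj₂ refl = IsTransp⇒∈ (IsTransp-sym abF)

    sameNext : ∀ x → x ∈ C → next C x ≡ next D x
    sameNext x x∈C with ∈-IsTransp abC x∈C
    ... | inj₁ refl = trans (next-IsTransp a≢b abC) (sym (next-IsTransp a≢b abD))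
    ... | inj₂ refl = trans (next-IsTransp (≢-sym a≢b) (IsTransp-sym abC))
                            (sym (next-IsTransp (≢-sym a≢b) (IsTransp-sym abD)))

  ∈-short-cycle : ∀ {a : Fin n} C → length C ≤ 2 → a ∈ C → C ≡ a ∷ [] ⊎ ∃[ b ] IsTransp a b C
  ∈-short-cycle (x ∷ [])     _ (here refl)         = inj₁ refl
  ∈-short-cycle (x ∷ y ∷ []) _ (here refl)         = inj₂ (y , inj₁ refl)
  ∈-short-cycle (x ∷ y ∷ []) _ (there (here refl)) = inj₂ (x , inj₂ refl)
  ∈-short-cycle (x ∷ y ∷ z ∷ _) (s≤s (s≤s ())) _

module _ {n : ℕ} (I : SF n) where
  open SF I

  worstOf-∈ : ∀ i (ps : List (Fin n)) → 1 ≤ length ps → worstOf I i ps ∈ ps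
  worstOf-∈ i (p ∷ qs) _ = go p qs
    where
    go : ∀ p qs → worstOf I i (p ∷ qs) ∈ p ∷ qs
    go p [] = here refl
    go p (q ∷ qs) with rank i q ≤? rank i p
    ... | yes _ with go p qs
    ...   | here w≡p     = here w≡p
    ...   | there w∈qs   = there (there w∈qs)
    go p (q ∷ qs) | no _ = there (go q qs)

module _ {n : ℕ} (I : SF n) (Π : Family n) (gsp : IsGSP I Π)
         (reduced : Reduced I Π) (noOdd : NoOddCycle>1 I Π) where
  open SF I
  open Family Π
  open import Data.List.Membership.DecPropositional (_≟_ {n}) using (_∈?_)

  private
    M : Fin n → Fin n → Set
    M = TranspIn I Π

    degree : Fin n → ℕ
    degree = deg I M (TranspIn? I Π)

    partnersOf : Fin n → List (Fin n)
    partnersOf = partners I M (TranspIn? I Π)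

  cyc-unique : ∀ r → Unique (cyc r)
  cyc-unique r = proj₂ (proj₁ gsp r)

  cyc-distinct : ∀ r s → r ≢ s → 2 ≤ length (cyc r) → ¬ SameCycle (cyc r) (cyc s)
  cyc-distinct = proj₁ (proj₂ gsp)

  no-blocking-transposition : ∀ a b → a ≢ b → ¬ M a b →
    ¬ (∃[ r ] ∃[ s ] (a ∈ cyc r × b ∈ cyc s × Prefers I a b (prev (cyc r) a) × Prefers I b a (prev (cyc s) b)))
  no-blocking-transposition = proj₁ (proj₂ (proj₂ (proj₂ gsp)))

  cycles-through≡cap : ∀ a → count (λ r → a ∈? cyc r) ≡ cap a
  cycles-through≡cap = proj₁ (proj₂ (proj₂ (proj₂ (proj₂ gsp))))

  cyc-length≤2 : ∀ r → length (cyc r) ≤ 2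
  cyc-length≤2 r = ≤2-if-not-even>2-nor-odd>1 (length (cyc r)) (reduced r) (noOdd r)

  M⇒≢ : ∀ {a b} → M a b → a ≢ b
  M⇒≢ (r , abr) = IsTransp⇒≢ (cyc-unique r) abr

  transp-index-unique : ∀ {a b r s} → IsTransp a b (cyc r) → IsTransp a b (cyc s) → r ≡ s
  transp-index-unique {r = r} {s} abr abs with r ≟ s
  ... | yes r≡s = r≡s
  ... | no r≢s  = ⊥-elim (cyc-distinct r s r≢s (IsTransp⇒2≤length abr)
                          (IsTransp⇒SameCycle (IsTransp⇒≢ (cyc-unique r) abr) abr abs))

  degree≤cap : ∀ a → degree a ≤ cap a
  degree≤cap a = subst (degree a ≤_) (cycles-through≡cap a)
    (count-≤-surjection (λ r → a ∈? cyc r) (TranspIn? I Π a) (λ r → next (cyc r) a)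
      λ (r , abr) → r , IsTransp⇒∈ abr , next-IsTransp (M⇒≢ (r , abr)) abr)

  InFixedPoint : Fin n → Set
  InFixedPoint a = ∃[ r ] cyc r ≡ a ∷ []

  inFixedPoint? : ∀ a → Dec (InFixedPoint a)
  inFixedPoint? a = any? λ r → ≡-dec _≟_ (cyc r) (a ∷ [])

  transp-through : ∀ {a r} → ¬ InFixedPoint a → a ∈ cyc r → IsTransp a (next (cyc r) a) (cyc r)
  transp-through {a} {r} ¬fixed a∈r with ∈-short-cycle (cyc r) (cyc-length≤2 r) a∈r
  ... | inj₁ r≡a     = ⊥-elim (¬fixed (r , r≡a))
  ... | inj₂ (b , abr) = subst (λ b → IsTransp a b (cyc r)) (sym (next-IsTransp (M⇒≢ (r , abr)) abr)) abr

  cap≤degree : ∀ {a} → ¬ InFixedPoint a → cap a ≤ degree a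
  cap≤degree {a} ¬fixed = subst (_≤ degree a) (cycles-through≡cap a)
    (count-≤-injection (λ r → a ∈? cyc r) (TranspIn? I Π a) (λ r → next (cyc r) a)
      (λ {r} a∈r → r , transp-through ¬fixed a∈r)
      λ {r} {s} a∈r a∈s next≡ → transp-index-unique (transp-through ¬fixed a∈r)
        (subst (λ b → IsTransp a b (cyc s)) (sym next≡) (transp-through ¬fixed a∈s)))

  prefers-over-some-prev : ∀ {a b} → a ≢ b → (degree a < cap a ⊎ Prefers I a b (worst I M (TranspIn? I Π) a)) →
                           ∃[ r ] a ∈ cyc r × Prefers I a b (prev (cyc r) a)
  prefers-over-some-prev {a} {b} a≢b room with inFixedPoint? a
  ... | yes (r , r≡a) =
    r , subst (a ∈_) (sym r≡a) (here refl) ,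
    subst (λ C → Prefers I a b (prev C a)) (sym r≡a)
      (subst (Prefers I a b) (sym (prev-singleton a)) (selfLast a b (≢-sym a≢b)))
  ... | no ¬fixed with room
  ...   | inj₁ degree<cap = ⊥-elim (<-irrefl refl (<-≤-trans degree<cap (cap≤degree ¬fixed)))
  ...   | inj₂ b≻worst
          with ∈-counted⁻ (TranspIn? I Π a) (worstOf-∈ I a (partnersOf a) (≤-trans (cap-pos a) (cap≤degree ¬fixed)))
  ...     | r , awr = r , IsTransp⇒∈ awr , subst (Prefers I a b) (sym (prev-IsTransp (M⇒≢ (r , awr)) awr)) b≻worst

  transpositions-matching : IsMatching I M (TranspIn? I Π)
  transpositions-matching = (λ a b (r , abr) → r , IsTransp-sym abr) , (λ a Maa → M⇒≢ Maa refl) , degree≤cap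

  transpositions-stable : Stable I M (TranspIn? I Π)
  transpositions-stable i j (i≢j , ¬Mij , room-j , room-i)
    with prefers-over-some-prev i≢j room-i | prefers-over-some-prev (≢-sym i≢j) room-j
  ... | r , i∈r , j≻prev | s , j∈s , i≻prev = no-blocking-transposition i j i≢j ¬Mij (r , s , i∈r , j∈s , j≻prev , i≻prev)

lemma13 : ∀ {n} (I : SF n) (Π : Family n) → IsGSP I Π → Reduced I Π → NoOddCycle>1 I Π
    → IsStableMatching I (transpMatching I Π) (TranspIn? I Π)
lemma13 I Π gsp reduced noOdd =
  transpositions-matching I Π gsp reduced noOdd , transpositions-stable I Π gsp reduced noOdd
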